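{- Let $T$ be a rooted binary tree, $S$ a set of leaves of $T$ with $|S|\ge 2$, and $\lambda_1\in S$. Let $v$ be the parent of $\lambda_1$ in $T[S]$. If $\lambda_2$ is a leaf of $T$ not in $S$ whose scar in $T[S]$ lies on one of the edges of $T[S]$ incident to $v$, then $T[S]$ is isomorphic (as a rooted tree) to $T[(S\setminus\{\lambda_1\})\cup\{\lambda_2\}]$.
   Context: A rooted tree is a tree with at least two vertices and a designated root vertex of degree $1$. Its leaves are the non-root vertices of degree $1$; internal vertices have degree at least $2$. A rooted binary tree is a rooted tree in which every internal vertex has degree $3$. The parent of a vertex $y$ is the neighbor of $y$ on the path from the root to $y$. An isomorphism of rooted trees is a graph isomorphism mapping root to root. For a set $S$ of leaves, $T\llbracket S\rrbracket$ is the union of the root-to-$s$ paths over $s\in S$, and the induced binary subtree $T[S]$ is obtained from $T\llbracket S\rrbracket$ by suppressing all degree-$2$ vertices; thus every vertex of $T[S]$ is identified with a vertex of $T$, and each edge $e$ of $T[S]$ corresponds to a path $P_e$ of $T\llbracket S\rrbracket$. For a leaf $w\notin S$, the scar of $w$ in $T[S]$ lies on the edge $e$ of $T[S]$ if the first vertex of $T\llbracket S\rrbracket$ met by the path from $w$ towards the root is an interior (degree-$2$) vertex of $P_e$. -}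

module Defs where

open import Data.Bool using (Bool; true; false; _∧_; _∨_; not)
open import Data.Maybe using (Maybe; just; nothing)
open import Data.Product using (Σ; _×_; _,_)
open import Data.Empty using (⊥)
open import Data.Sum using (_⊎_)
open import Relation.Nullary using (¬_)
open import Data.Unit using (⊤)
open import Relation.Binary.PropositionalEquality using (_≡_; _≢_)
open import Function using (_∘_)

-- A rooted binary tree T is encoded by the (unlabelled) binary tree hanging
-- below the unique neighbour of the root: the root is an extra vertex 'rt'
-- of degree 1 joined to the top node of this shape.  'nd l r' is an internal
-- vertex (degree 3: parent + two children), 'lf' a leaf.
data BTree : Set where
  lf : BTree
  nd : BTree → BTree → BTree

-- Non-root vertices of T: positions in the shape.
data Pos : BTree → Set where
  here  : ∀ {t} → Pos t
  left  : ∀ {l r} → Pos l → Pos (nd l r)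
  right : ∀ {l r} → Pos r → Pos (nd l r)

data V (t : BTree) : Set where
  rt : V t
  ps : Pos t → V t

subtree : ∀ {t} → Pos t → BTree
subtree {t} here = t
subtree (left p) = subtree p
subtree (right p) = subtree p

IsLeaf : ∀ {t} → Pos t → Set
IsLeaf p = subtree p ≡ lf

eqPos : ∀ {t} → Pos t → Pos t → Bool
eqPos here here = true
eqPos (left p) (left q) = eqPos p q
eqPos (right p) (right q) = eqPos p q
eqPos _ _ = false

data _⊑_ : ∀ {t} → Pos t → Pos t → Set where
  here⊑  : ∀ {t} {q : Pos t} → here ⊑ q
  left⊑  : ∀ {l r} {p q : Pos l} → p ⊑ q → left {l} {r} p ⊑ left q
  right⊑ : ∀ {l r} {p q : Pos r} → p ⊑ q → right {l} {r} p ⊑ right q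

data _⊑V_ {t : BTree} : V t → V t → Set where
  rt⊑ : ∀ {x} → rt ⊑V x
  ps⊑ : ∀ {p q} → p ⊑ q → ps p ⊑V ps q

_⊏V_ : ∀ {t} → V t → V t → Set
x ⊏V y = x ⊑V y × x ≢ y

-- A set S of leaves is a boolean predicate on positions (true only on leaves).
LeafSet : BTree → Set
LeafSet t = Pos t → Bool

AtLeastTwo : ∀ {t} → LeafSet t → Set
AtLeastTwo {t} S = Σ (Pos t) λ a → Σ (Pos t) λ b → a ≢ b × S a ≡ true × S b ≡ true

-- membership of a vertex in T⟦S⟧ (union of root-to-s paths, s ∈ S)
InSpan : ∀ {t} → LeafSet t → Pos t → Set
InSpan {t} S p = Σ (Pos t) λ q → p ⊑ q × S q ≡ true

InSpanV : ∀ {t} → LeafSet t → V t → Set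
InSpanV {t} S rt = Σ (Pos t) λ q → S q ≡ true
InSpanV S (ps p) = InSpan S p

-- p is an internal vertex both of whose children lie in T⟦S⟧
-- (i.e. p has degree 3 in T⟦S⟧)
Branch : ∀ {t} → LeafSet t → Pos t → Set
Branch {lf} S here = ⊥
Branch {nd l r} S here = InSpan (S ∘ left) here × InSpan (S ∘ right) here
Branch {nd l r} S (left p) = Branch (S ∘ left) p
Branch {nd l r} S (right p) = Branch (S ∘ right) p

-- vertices of T[S] (as vertices of T): the root, the leaves in S, and the
-- vertices of degree 3 in T⟦S⟧ (those not suppressed)
VertexS : ∀ {t} → LeafSet t → V t → Set
VertexS S rt = ⊤
VertexS S (ps p) = (S p ≡ true) ⊎ Branch S p

-- (u , x) is an edge of T[S]: both are vertices of T[S], x ∈ T⟦S⟧, u is a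
-- proper ancestor of x, and no vertex of T[S] lies strictly between them
-- (so the path P_e from u to x lies in T⟦S⟧ with all interior vertices of
-- degree 2 there).
EdgeS : ∀ {t} → LeafSet t → V t → V t → Set
EdgeS {t} S u x =
  VertexS S u × VertexS S x × InSpanV S x × u ⊏V x ×
  ((y : V t) → u ⊏V y → y ⊏V x → ¬ VertexS S y)

-- x is the first vertex of T⟦S⟧ met by the path from the leaf w towards
-- the root
ScarVertex : ∀ {t} → LeafSet t → Pos t → V t → Set
ScarVertex {t} S w x =
  x ⊑V ps w × InSpanV S x × ((y : V t) → y ⊑V ps w → InSpanV S y → y ⊑V x)

Interior : ∀ {t} → V t → V t → V t → Set
Interior x u y = u ⊏V x × x ⊏V y

exchange : ∀ {t} → LeafSet t → Pos t → Pos t → LeafSet t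
exchange S l₁ l₂ p = (S p ∧ not (eqPos p l₁)) ∨ eqPos p l₂

-- the shape of the induced binary subtree T[S] (below the root), obtained by
-- suppressing degree-2 vertices; nothing if S is empty
restrict : (t : BTree) → LeafSet t → Maybe BTree
restrict lf S with S here
... | true = just lf
... | false = nothing
restrict (nd l r) S = combine (restrict l (S ∘ left)) (restrict r (S ∘ right))
  where
  combine : Maybe BTree → Maybe BTree → Maybe BTree
  combine (just a) (just b) = just (nd a b)
  combine (just a) nothing = just a
  combine nothing (just b) = just b
  combine nothing nothing = nothing

data _≅_ : BTree → BTree → Set where
  lf≅   : lf ≅ lf
  nd≅   : ∀ {a b c d} → a ≅ c → b ≅ d → nd a b ≅ nd c d
  swap≅ : ∀ {a b c d} → a ≅ d → b ≅ c → nd a b ≅ nd c d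

data _≅M_ : Maybe BTree → Maybe BTree → Set where
  nothing≅ : nothing ≅M nothing
  just≅    : ∀ {a b} → a ≅ b → just a ≅M just b

-- Write R = S ∖ {λ₁}, so that S = R ∪ {λ₁} and S' = R ∪ {λ₂}.  If ℓ is the
-- only leaf of a set below one child of a vertex w, the induced tree below w
-- consists of the leaf ℓ and the induced tree of the set without ℓ below w,
-- joined at a new vertex.
-- This applies to S and λ₁ at the parent v of λ₁, and to S' and λ₂ at the
-- scar vertex x of λ₂ (or at v, when the scar lies on the edge from v to λ₁).
-- Since the scar lies on an edge at v, no branch vertex of T[S] separates v
-- from x, so T[R] below v and below x coincide.  Hence T[S] and T[S'] agree
-- below the upper of v and x, and above it S and S' agree.

module Submission where

open import Defs
open import Data.Bool using (true; false; _∧_; _∨_; not)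
open import Data.Bool.Properties using (¬-not; not-¬; ∧-identityʳ; ∧-zeroʳ; ∨-identityʳ; ∨-zeroʳ)
open import Data.Empty using (⊥-elim)
open import Data.Maybe using (Maybe; just; nothing)
open import Data.Product using (Σ; ∃; ∃₂; _×_; _,_; proj₁)
open import Data.Sum using (_⊎_; inj₁; inj₂) renaming (map to ⊎-map)
open import Function using (_∘_)
open import Relation.Binary.Bundles using (Setoid)
open import Relation.Binary.Structures using (IsEquivalence)
import Relation.Binary.Reasoning.Setoid as SetoidReasoning
open import Relation.Nullary using (¬_; Dec; yes; no)
open import Relation.Binary.PropositionalEquality using (_≡_; _≢_; refl; sym; trans; cong; cong₂; subst)

⊑-refl : ∀ {t} {p : Pos t} → p ⊑ p
⊑-refl {p = here} = here⊑
⊑-refl {p = left p} = left⊑ ⊑-refl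
⊑-refl {p = right p} = right⊑ ⊑-refl

⊑-trans : ∀ {t} {p q r : Pos t} → p ⊑ q → q ⊑ r → p ⊑ r
⊑-trans here⊑ _ = here⊑
⊑-trans (left⊑ p⊑q) (left⊑ q⊑r) = left⊑ (⊑-trans p⊑q q⊑r)
⊑-trans (right⊑ p⊑q) (right⊑ q⊑r) = right⊑ (⊑-trans p⊑q q⊑r)

⊑-antisym : ∀ {t} {p q : Pos t} → p ⊑ q → q ⊑ p → p ≡ q
⊑-antisym here⊑ here⊑ = refl
⊑-antisym (left⊑ p⊑q) (left⊑ q⊑p) = cong left (⊑-antisym p⊑q q⊑p)
⊑-antisym (right⊑ p⊑q) (right⊑ q⊑p) = cong right (⊑-antisym p⊑q q⊑p)

⊑-left⁻¹ : ∀ {l r} {p q : Pos l} → left {l} {r} p ⊑ left q → p ⊑ q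
⊑-left⁻¹ (left⊑ p⊑q) = p⊑q

⊑-right⁻¹ : ∀ {l r} {p q : Pos r} → right {l} {r} p ⊑ right q → p ⊑ q
⊑-right⁻¹ (right⊑ p⊑q) = p⊑q

left⋢right : ∀ {l r} {p : Pos l} {q : Pos r} → ¬ left p ⊑ right q
left⋢right ()

right⋢left : ∀ {l r} {p : Pos r} {q : Pos l} → ¬ right p ⊑ left q
right⋢left ()

⊑-comparable : ∀ {t} {p q r : Pos t} → p ⊑ r → q ⊑ r → p ⊑ q ⊎ q ⊑ p
⊑-comparable here⊑ _ = inj₁ here⊑
⊑-comparable _ here⊑ = inj₂ here⊑
⊑-comparable (left⊑ p⊑r) (left⊑ q⊑r) = ⊎-map left⊑ left⊑ (⊑-comparable p⊑r q⊑r)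
⊑-comparable (right⊑ p⊑r) (right⊑ q⊑r) = ⊎-map right⊑ right⊑ (⊑-comparable p⊑r q⊑r)

leaf-maximal : ∀ {t} {p q : Pos t} → IsLeaf p → p ⊑ q → p ≡ q
leaf-maximal {lf} {here} {here} _ here⊑ = refl
leaf-maximal {nd _ _} {here} () here⊑
leaf-maximal leaf (left⊑ p⊑q) = cong left (leaf-maximal leaf p⊑q)
leaf-maximal leaf (right⊑ p⊑q) = cong right (leaf-maximal leaf p⊑q)

_⊑?_ : ∀ {t} (p q : Pos t) → Dec (p ⊑ q)
here ⊑? q = yes here⊑
left p ⊑? here = no λ ()
left p ⊑? right q = no λ ()
right p ⊑? here = no λ ()
right p ⊑? left q = no λ ()
left p ⊑? left q with p ⊑? q
... | yes p⊑q = yes (left⊑ p⊑q)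
... | no p⋢q = no (p⋢q ∘ ⊑-left⁻¹)
right p ⊑? right q with p ⊑? q
... | yes p⊑q = yes (right⊑ p⊑q)
... | no p⋢q = no (p⋢q ∘ ⊑-right⁻¹)

eqPos-refl : ∀ {t} (p : Pos t) → eqPos p p ≡ true
eqPos-refl here = refl
eqPos-refl (left p) = eqPos-refl p
eqPos-refl (right p) = eqPos-refl p

eqPos-sound : ∀ {t} {p q : Pos t} → eqPos p q ≡ true → p ≡ q
eqPos-sound {p = here} {here} _ = refl
eqPos-sound {p = left p} {left q} eq = cong left (eqPos-sound eq)
eqPos-sound {p = right p} {right q} eq = cong right (eqPos-sound eq)
eqPos-sound {p = here} {left _} ()
eqPos-sound {p = here} {right _} ()
eqPos-sound {p = left _} {here} ()
eqPos-sound {p = left _} {right _} ()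
eqPos-sound {p = right _} {here} ()
eqPos-sound {p = right _} {left _} ()

eqPos-false : ∀ {t} {p q : Pos t} → p ≢ q → eqPos p q ≡ false
eqPos-false p≢q = ¬-not (p≢q ∘ eqPos-sound)

_≟_ : ∀ {t} (p q : Pos t) → Dec (p ≡ q)
p ≟ q with eqPos p q in eq
... | true = yes (eqPos-sound eq)
... | false = no λ p≡q → not-¬ (eqPos-refl q) (subst (λ z → eqPos z q ≡ false) p≡q eq)

_⊏_ : ∀ {t} → Pos t → Pos t → Set
p ⊏ q = p ⊑ q × p ≢ q

⊏-ps : ∀ {t} {p q : Pos t} → p ⊏ q → ps p ⊏V ps q
⊏-ps (p⊑q , p≢q) = ps⊑ p⊑q , λ { refl → p≢q refl }

ps-⊏ : ∀ {t} {p q : Pos t} → ps p ⊏V ps q → p ⊏ q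
ps-⊏ (ps⊑ p⊑q , p≢q) = p⊑q , p≢q ∘ cong ps

ps-injective : ∀ {t} {p q : Pos t} → ps p ≡ ps q → p ≡ q
ps-injective refl = refl

⊑V-refl : ∀ {t} {x : V t} → x ⊑V x
⊑V-refl {x = rt} = rt⊑
⊑V-refl {x = ps _} = ps⊑ ⊑-refl

⊑V-trans : ∀ {t} {x y z : V t} → x ⊑V y → y ⊑V z → x ⊑V z
⊑V-trans rt⊑ _ = rt⊑
⊑V-trans (ps⊑ p⊑q) (ps⊑ q⊑r) = ps⊑ (⊑-trans p⊑q q⊑r)

⊑V-antisym : ∀ {t} {x y : V t} → x ⊑V y → y ⊑V x → x ≡ y
⊑V-antisym rt⊑ rt⊑ = refl
⊑V-antisym (ps⊑ p⊑q) (ps⊑ q⊑p) = cong ps (⊑-antisym p⊑q q⊑p)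

⊏V-⊑V-trans : ∀ {t} {x y z : V t} → x ⊏V y → y ⊑V z → x ⊏V z
⊏V-⊑V-trans (x⊑y , x≢y) y⊑z = ⊑V-trans x⊑y y⊑z , λ { refl → x≢y (⊑V-antisym x⊑y y⊑z) }

branch-not-leaf : ∀ {t} {S : LeafSet t} {m : Pos t} → Branch S m → ¬ IsLeaf m
branch-not-leaf {lf} {m = here} ()
branch-not-leaf {nd _ _} {m = here} _ ()
branch-not-leaf {nd _ _} {S} {left m} = branch-not-leaf {S = S ∘ left} {m}
branch-not-leaf {nd _ _} {S} {right m} = branch-not-leaf {S = S ∘ right} {m}

record CommonBranch {t} (S : LeafSet t) (p q : Pos t) : Set where
  field
    at       : Pos t
    at⊑₁     : at ⊑ p
    at⊑₂     : at ⊑ q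
    branches : Branch S at
    greatest : ∀ {w} → w ⊑ p → w ⊑ q → w ⊑ at

common-branch-left : ∀ {l r} {S : LeafSet (nd l r)} {p q : Pos l} →
  CommonBranch (S ∘ left) p q → CommonBranch S (left p) (left q)
common-branch-left m = record
  { at = left at ; at⊑₁ = left⊑ at⊑₁ ; at⊑₂ = left⊑ at⊑₂ ; branches = branches
  ; greatest = λ { here⊑ _ → here⊑ ; (left⊑ w⊑p) (left⊑ w⊑q) → left⊑ (greatest w⊑p w⊑q) } }
  where open CommonBranch m

common-branch-right : ∀ {l r} {S : LeafSet (nd l r)} {p q : Pos r} →
  CommonBranch (S ∘ right) p q → CommonBranch S (right p) (right q)
common-branch-right m = record
  { at = right at ; at⊑₁ = right⊑ at⊑₁ ; at⊑₂ = right⊑ at⊑₂ ; branches = branches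
  ; greatest = λ { here⊑ _ → here⊑ ; (right⊑ w⊑p) (right⊑ w⊑q) → right⊑ (greatest w⊑p w⊑q) } }
  where open CommonBranch m

meet : ∀ {t} {S : LeafSet t} {p q : Pos t} → S p ≡ true → S q ≡ true →
  ¬ p ⊑ q → ¬ q ⊑ p → CommonBranch S p q
meet {p = here} _ _ p⋢q _ = ⊥-elim (p⋢q here⊑)
meet {p = left _} {here} _ _ _ q⋢p = ⊥-elim (q⋢p here⊑)
meet {p = right _} {here} _ _ _ q⋢p = ⊥-elim (q⋢p here⊑)
meet {p = left p} {right q} Sp Sq _ _ = record
  { at = here ; at⊑₁ = here⊑ ; at⊑₂ = here⊑
  ; branches = (p , here⊑ , Sp) , (q , here⊑ , Sq) ; greatest = λ { here⊑ _ → here⊑ } }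
meet {p = right p} {left q} Sp Sq _ _ = record
  { at = here ; at⊑₁ = here⊑ ; at⊑₂ = here⊑
  ; branches = (q , here⊑ , Sq) , (p , here⊑ , Sp) ; greatest = λ { here⊑ _ → here⊑ } }
meet {p = left _} {left _} Sp Sq p⋢q q⋢p =
  common-branch-left (meet Sp Sq (p⋢q ∘ left⊑) (q⋢p ∘ left⊑))
meet {p = right _} {right _} Sp Sq p⋢q q⋢p =
  common-branch-right (meet Sp Sq (p⋢q ∘ right⊑) (q⋢p ∘ right⊑))

meet-leaves : ∀ {t} {S : LeafSet t} {p q : Pos t} → ((s : Pos t) → S s ≡ true → IsLeaf s) →
  S p ≡ true → S q ≡ true → p ≢ q → CommonBranch S p q
meet-leaves leaves Sp Sq p≢q =
  meet Sp Sq (p≢q ∘ leaf-maximal (leaves _ Sp)) (p≢q ∘ sym ∘ leaf-maximal (leaves _ Sq))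

NoneBelow : ∀ {t} → LeafSet t → Pos t → Set
NoneBelow S w = ∀ {q} → w ⊑ q → S q ≢ true

Confined : ∀ {t} → LeafSet t → Pos t → Pos t → Set
Confined S w w' = ∀ {q} → w ⊑ q → S q ≡ true → w' ⊑ q

BranchFree : ∀ {t} → LeafSet t → Pos t → Pos t → Set
BranchFree S w w' = ∀ {m} → w ⊑ m → m ⊏ w' → ¬ Branch S m

-- An S-leaf below w but not below w' meets an S-leaf below w' in a branch
-- vertex lying in [w, w').
branchFree⇒confined : ∀ {t} {S : LeafSet t} {w w' : Pos t} → ((p : Pos t) → S p ≡ true → IsLeaf p) →
  w ⊑ w' → InSpan S w' → BranchFree S w w' → Confined S w w'
branchFree⇒confined {w' = w'} leaves w⊑w' (s , w'⊑s , Ss) free {q} w⊑q Sq with w' ⊑? q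
... | yes w'⊑q = w'⊑q
... | no w'⋢q = ⊥-elim (free (greatest w⊑q (⊑-trans w⊑w' w'⊑s)) at⊏w' branches)
  where
  open CommonBranch (meet-leaves leaves Sq Ss λ q≡s → w'⋢q (subst (w' ⊑_) (sym q≡s) w'⊑s))
  at⊏w' : at ⊏ w'
  at⊏w' with ⊑-comparable at⊑₂ w'⊑s
  ... | inj₁ at⊑w' = at⊑w' , λ at≡w' → w'⋢q (subst (_⊑ q) at≡w' at⊑₁)
  ... | inj₂ w'⊑at = ⊥-elim (w'⋢q (⊑-trans w'⊑at at⊑₁))

edge-branchFree : ∀ {t} {S : LeafSet t} {u y : V t} {p q : Pos t} →
  EdgeS S u y → u ⊏V ps p → ps q ⊑V y → BranchFree S p q
edge-branchFree (_ , _ , _ , _ , no-vertex) u⊏p q⊑y p⊑m m⊏q branch =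
  no-vertex _ (⊏V-⊑V-trans u⊏p (ps⊑ p⊑m)) (⊏V-⊑V-trans (⊏-ps m⊏q) q⊑y) (inj₂ branch)

another-leaf : ∀ {t} {S : LeafSet t} → AtLeastTwo S → (p : Pos t) → ∃ λ s → S s ≡ true × s ≢ p
another-leaf (a , b , a≢b , Sa , Sb) p with a ≟ p
... | yes a≡p = b , Sb , λ b≡p → a≢b (trans a≡p (sym b≡p))
... | no a≢p = a , Sa , a≢p

parent-not-root : ∀ {t} {S : LeafSet t} {λ₁ : Pos t} → ((p : Pos t) → S p ≡ true → IsLeaf p) →
  AtLeastTwo S → S λ₁ ≡ true → ¬ EdgeS S rt (ps λ₁)
parent-not-root {S = S} {λ₁} leaves two Sλ₁ (_ , _ , _ , _ , no-vertex) with another-leaf two λ₁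
... | s , Ss , s≢λ₁ = no-vertex (ps at) (rt⊑ , λ ()) (ps⊑ at⊑₁ , at≢λ₁) (inj₂ branches)
  where
  open CommonBranch (meet-leaves leaves Sλ₁ Ss (s≢λ₁ ∘ sym))
  at≢λ₁ : ps at ≢ ps λ₁
  at≢λ₁ at≡λ₁ = branch-not-leaf {S = S} {at} branches (subst IsLeaf (sym (ps-injective at≡λ₁)) (leaves λ₁ Sλ₁))

≅-refl : ∀ {a} → a ≅ a
≅-refl {lf} = lf≅
≅-refl {nd _ _} = nd≅ ≅-refl ≅-refl

≅-sym : ∀ {a b} → a ≅ b → b ≅ a
≅-sym lf≅ = lf≅
≅-sym (nd≅ a≅c b≅d) = nd≅ (≅-sym a≅c) (≅-sym b≅d)
≅-sym (swap≅ a≅d b≅c) = swap≅ (≅-sym b≅c) (≅-sym a≅d)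

≅-trans : ∀ {a b c} → a ≅ b → b ≅ c → a ≅ c
≅-trans lf≅ lf≅ = lf≅
≅-trans (nd≅ x y) (nd≅ x' y') = nd≅ (≅-trans x x') (≅-trans y y')
≅-trans (nd≅ x y) (swap≅ x' y') = swap≅ (≅-trans x x') (≅-trans y y')
≅-trans (swap≅ x y) (nd≅ x' y') = swap≅ (≅-trans x y') (≅-trans y x')
≅-trans (swap≅ x y) (swap≅ x' y') = nd≅ (≅-trans x y') (≅-trans y x')

≅M-isEquivalence : IsEquivalence _≅M_
≅M-isEquivalence = record { refl = refl′ ; sym = sym′ ; trans = trans′ }
  where
  refl′ : ∀ {a} → a ≅M a
  refl′ {nothing} = nothing≅
  refl′ {just _} = just≅ ≅-refl
  sym′ : ∀ {a b} → a ≅M b → b ≅M a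
  sym′ nothing≅ = nothing≅
  sym′ (just≅ a≅b) = just≅ (≅-sym a≅b)
  trans′ : ∀ {a b c} → a ≅M b → b ≅M c → a ≅M c
  trans′ nothing≅ nothing≅ = nothing≅
  trans′ (just≅ a≅b) (just≅ b≅c) = just≅ (≅-trans a≅b b≅c)

≅M-setoid : Setoid _ _
≅M-setoid = record { isEquivalence = ≅M-isEquivalence }

open Setoid ≅M-setoid using () renaming (refl to ≅M-refl; reflexive to ≅M-reflexive)
open SetoidReasoning ≅M-setoid

combine : Maybe BTree → Maybe BTree → Maybe BTree
combine (just a) (just b) = just (nd a b)
combine (just a) nothing = just a
combine nothing (just b) = just b
combine nothing nothing = nothing

combine-nothingˡ : ∀ m → combine nothing m ≡ m
combine-nothingˡ (just _) = refl
combine-nothingˡ nothing = refl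

combine-nothingʳ : ∀ m → combine m nothing ≡ m
combine-nothingʳ (just _) = refl
combine-nothingʳ nothing = refl

combine-comm : ∀ m n → combine m n ≅M combine n m
combine-comm (just _) (just _) = just≅ (swap≅ ≅-refl ≅-refl)
combine-comm (just _) nothing = ≅M-refl
combine-comm nothing (just _) = ≅M-refl
combine-comm nothing nothing = ≅M-refl

combine-cong : ∀ {m m' n n'} → m ≅M m' → n ≅M n' → combine m n ≅M combine m' n'
combine-cong nothing≅ nothing≅ = nothing≅
combine-cong nothing≅ (just≅ b) = just≅ b
combine-cong (just≅ a) nothing≅ = just≅ a
combine-cong (just≅ a) (just≅ b) = just≅ (nd≅ a b)

restrict-nd : ∀ {l r} (S : LeafSet (nd l r)) →
  restrict (nd l r) S ≡ combine (restrict l (S ∘ left)) (restrict r (S ∘ right))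
restrict-nd {l} {r} S with restrict l (S ∘ left) | restrict r (S ∘ right)
... | just _ | just _ = refl
... | just _ | nothing = refl
... | nothing | just _ = refl
... | nothing | nothing = refl

restrictAt : ∀ {t} → LeafSet t → Pos t → Maybe BTree
restrictAt {t} S here = restrict t S
restrictAt {nd _ _} S (left p) = restrictAt (S ∘ left) p
restrictAt {nd _ _} S (right p) = restrictAt (S ∘ right) p

restrictAt-cong : ∀ {t} {S S' : LeafSet t} (w : Pos t) → (∀ {q} → w ⊑ q → S q ≡ S' q) →
  restrictAt S w ≡ restrictAt S' w
restrictAt-cong {lf} here eq rewrite eq {here} here⊑ = refl
restrictAt-cong {nd _ _} {S} {S'} here eq =
  trans (restrict-nd S)
    (trans (cong₂ combine (restrictAt-cong {S = S ∘ left} {S' ∘ left} here λ _ → eq here⊑)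
                          (restrictAt-cong {S = S ∘ right} {S' ∘ right} here λ _ → eq here⊑))
      (sym (restrict-nd S')))
restrictAt-cong {nd _ _} (left w) eq = restrictAt-cong w (eq ∘ left⊑)
restrictAt-cong {nd _ _} (right w) eq = restrictAt-cong w (eq ∘ right⊑)

restrictAt-none : ∀ {t} {S : LeafSet t} (w : Pos t) → NoneBelow S w → restrictAt S w ≡ nothing
restrictAt-none {lf} here none rewrite ¬-not (none {here} here⊑) = refl
restrictAt-none {nd _ _} {S} here none =
  trans (restrict-nd S) (cong₂ combine (restrictAt-none {S = S ∘ left} here λ _ → none here⊑)
                                       (restrictAt-none {S = S ∘ right} here λ _ → none here⊑))
restrictAt-none {nd _ _} (left w) none = restrictAt-none w (none ∘ left⊑)
restrictAt-none {nd _ _} (right w) none = restrictAt-none w (none ∘ right⊑)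

restrictAt-leaf : ∀ {t} {S : LeafSet t} (p : Pos t) → IsLeaf p → S p ≡ true → restrictAt S p ≡ just lf
restrictAt-leaf {lf} here _ Sp rewrite Sp = refl
restrictAt-leaf {nd _ _} here ()
restrictAt-leaf {nd _ _} (left p) = restrictAt-leaf p
restrictAt-leaf {nd _ _} (right p) = restrictAt-leaf p

restrictAt-collapse : ∀ {t} {S : LeafSet t} {w w' : Pos t} → w ⊑ w' → Confined S w w' →
  restrictAt S w ≡ restrictAt S w'
restrictAt-collapse {w' = here} here⊑ _ = refl
restrictAt-collapse {nd _ _} {S} {w' = left _} here⊑ conf =
  trans (restrict-nd S)
    (trans (cong₂ combine (restrictAt-collapse {S = S ∘ left} here⊑ λ _ Sq → ⊑-left⁻¹ (conf here⊑ Sq))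
                          (restrictAt-none {S = S ∘ right} here λ _ Sq → left⋢right (conf here⊑ Sq)))
      (combine-nothingʳ _))
restrictAt-collapse {nd _ _} {S} {w' = right _} here⊑ conf =
  trans (restrict-nd S)
    (trans (cong₂ combine (restrictAt-none {S = S ∘ left} here λ _ Sq → right⋢left (conf here⊑ Sq))
                          (restrictAt-collapse {S = S ∘ right} here⊑ λ _ Sq → ⊑-right⁻¹ (conf here⊑ Sq)))
      (combine-nothingˡ _))
restrictAt-collapse (left⊑ w⊑w') conf =
  restrictAt-collapse w⊑w' λ w⊑q Sq → ⊑-left⁻¹ (conf (left⊑ w⊑q) Sq)
restrictAt-collapse (right⊑ w⊑w') conf =
  restrictAt-collapse w⊑w' λ w⊑q Sq → ⊑-right⁻¹ (conf (right⊑ w⊑q) Sq)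

restrictAt-≅⇒restrict-≅ : ∀ {t} {S S' : LeafSet t} (w : Pos t) → (∀ {q} → ¬ w ⊑ q → S q ≡ S' q) →
  restrictAt S w ≅M restrictAt S' w → restrict t S ≅M restrict t S'
restrictAt-≅⇒restrict-≅ here _ iso = iso
restrictAt-≅⇒restrict-≅ {nd _ _} {S} {S'} (left w) outside iso = begin
  restrict _ S                                          ≡⟨ restrict-nd S ⟩
  combine (restrictAt (S ∘ left) here) (restrictAt (S ∘ right) here)
    ≈⟨ combine-cong (restrictAt-≅⇒restrict-≅ w (λ w⋢q → outside (w⋢q ∘ ⊑-left⁻¹)) iso)
                    (≅M-reflexive (restrictAt-cong {S = S ∘ right} {S' ∘ right} here λ _ → outside left⋢right)) ⟩
  combine (restrictAt (S' ∘ left) here) (restrictAt (S' ∘ right) here) ≡⟨ restrict-nd S' ⟨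
  restrict _ S'                                         ∎
restrictAt-≅⇒restrict-≅ {nd _ _} {S} {S'} (right w) outside iso = begin
  restrict _ S                                          ≡⟨ restrict-nd S ⟩
  combine (restrictAt (S ∘ left) here) (restrictAt (S ∘ right) here)
    ≈⟨ combine-cong (≅M-reflexive (restrictAt-cong {S = S ∘ left} {S' ∘ left} here λ _ → outside right⋢left))
                    (restrictAt-≅⇒restrict-≅ w (λ w⋢q → outside (w⋢q ∘ ⊑-right⁻¹)) iso) ⟩
  combine (restrictAt (S' ∘ left) here) (restrictAt (S' ∘ right) here) ≡⟨ restrict-nd S' ⟨
  restrict _ S'                                         ∎

data Children : ∀ {t} → Pos t → Pos t → Pos t → Set where
  here-lr  : ∀ {l r} → Children {nd l r} here (left here) (right here)
  here-rl  : ∀ {l r} → Children {nd l r} here (right here) (left here)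
  in-left  : ∀ {l r} {w a b : Pos l} → Children w a b → Children {nd l r} (left w) (left a) (left b)
  in-right : ∀ {l r} {w a b : Pos r} → Children w a b → Children {nd l r} (right w) (right a) (right b)

children-sym : ∀ {t} {w a b : Pos t} → Children w a b → Children w b a
children-sym here-lr = here-rl
children-sym here-rl = here-lr
children-sym (in-left ch) = in-left (children-sym ch)
children-sym (in-right ch) = in-right (children-sym ch)

children-⊏ : ∀ {t} {w a b : Pos t} → Children w a b → w ⊏ a
children-⊏ here-lr = here⊑ , λ ()
children-⊏ here-rl = here⊑ , λ ()
children-⊏ (in-left ch) with children-⊏ ch
... | w⊑a , w≢a = left⊑ w⊑a , λ { refl → w≢a refl }
children-⊏ (in-right ch) with children-⊏ ch
... | w⊑a , w≢a = right⊑ w⊑a , λ { refl → w≢a refl }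

children-cover : ∀ {t} {w a b q : Pos t} → Children w a b → w ⊏ q → a ⊑ q ⊎ b ⊑ q
children-cover {q = here} here-lr (_ , here≢here) = ⊥-elim (here≢here refl)
children-cover {q = left _} here-lr _ = inj₁ (left⊑ here⊑)
children-cover {q = right _} here-lr _ = inj₂ (right⊑ here⊑)
children-cover {q = here} here-rl (_ , here≢here) = ⊥-elim (here≢here refl)
children-cover {q = left _} here-rl _ = inj₂ (left⊑ here⊑)
children-cover {q = right _} here-rl _ = inj₁ (right⊑ here⊑)
children-cover (in-left ch) (left⊑ w⊑q , w≢q) =
  ⊎-map left⊑ left⊑ (children-cover ch (w⊑q , w≢q ∘ cong left))
children-cover (in-right ch) (right⊑ w⊑q , w≢q) =
  ⊎-map right⊑ right⊑ (children-cover ch (w⊑q , w≢q ∘ cong right))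

children-disjoint : ∀ {t} {w a b q : Pos t} → Children w a b → a ⊑ q → ¬ b ⊑ q
children-disjoint here-lr (left⊑ _) ()
children-disjoint here-rl (right⊑ _) ()
children-disjoint (in-left ch) (left⊑ a⊑q) (left⊑ b⊑q) = children-disjoint ch a⊑q b⊑q
children-disjoint (in-right ch) (right⊑ a⊑q) (right⊑ b⊑q) = children-disjoint ch a⊑q b⊑q

children-split : ∀ {t} {w a b : Pos t} → Children w a b → (S : LeafSet t) →
  restrictAt S w ≅M combine (restrictAt S a) (restrictAt S b)
children-split here-lr S = ≅M-reflexive (restrict-nd S)
children-split here-rl S = begin
  restrict _ S                                    ≡⟨ restrict-nd S ⟩
  combine (restrict _ (S ∘ left)) (restrict _ (S ∘ right)) ≈⟨ combine-comm _ _ ⟩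
  combine (restrict _ (S ∘ right)) (restrict _ (S ∘ left)) ∎
children-split (in-left ch) S = children-split ch (S ∘ left)
children-split (in-right ch) S = children-split ch (S ∘ right)

child-toward : ∀ {t} {w q : Pos t} → w ⊏ q → ∃₂ λ a b → Children w a b × a ⊑ q
child-toward {w = here} {here} (_ , here≢here) = ⊥-elim (here≢here refl)
child-toward {w = here} {left _} _ = left here , right here , here-lr , left⊑ here⊑
child-toward {w = here} {right _} _ = right here , left here , here-rl , right⊑ here⊑
child-toward (left⊑ w⊑q , w≢q) with child-toward (w⊑q , w≢q ∘ cong left)
... | a , b , ch , a⊑q = left a , left b , in-left ch , left⊑ a⊑q
child-toward (right⊑ w⊑q , w≢q) with child-toward (w⊑q , w≢q ∘ cong right)
... | a , b , ch , a⊑q = right a , right b , in-right ch , right⊑ a⊑q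

restrictAt-empty-child : ∀ {t} {S : LeafSet t} {w a b : Pos t} → Children w a b → NoneBelow S a →
  restrictAt S w ≅M restrictAt S b
restrictAt-empty-child {S = S} {w} {a} {b} ch none = begin
  restrictAt S w                              ≈⟨ children-split ch S ⟩
  combine (restrictAt S a) (restrictAt S b)   ≡⟨ cong (λ m → combine m _) (restrictAt-none a none) ⟩
  combine nothing (restrictAt S b)            ≡⟨ combine-nothingˡ _ ⟩
  restrictAt S b                              ∎

_⊆_ : ∀ {t} → LeafSet t → LeafSet t → Set
R ⊆ S = ∀ {q} → R q ≡ true → S q ≡ true

record Inserts {t} (ℓ : Pos t) (R S : LeafSet t) : Set where
  field
    absent  : R ℓ ≡ false
    present : S ℓ ≡ true
    agrees  : ∀ {q} → q ≢ ℓ → S q ≡ R q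
open Inserts

remove : ∀ {t} → LeafSet t → Pos t → LeafSet t
remove S ℓ p = S p ∧ not (eqPos p ℓ)

remove-inserts : ∀ {t} {S : LeafSet t} {ℓ : Pos t} → S ℓ ≡ true → Inserts ℓ (remove S ℓ) S
remove-inserts {S = S} {ℓ} Sℓ = record
  { absent = trans (cong (λ b → S ℓ ∧ not b) (eqPos-refl ℓ)) (∧-zeroʳ (S ℓ))
  ; present = Sℓ
  ; agrees = λ {q} q≢ℓ → sym (trans (cong (λ b → S q ∧ not b) (eqPos-false q≢ℓ)) (∧-identityʳ (S q)))
  }

exchange-inserts : ∀ {t} {S : LeafSet t} {ℓ₁ ℓ₂ : Pos t} → S ℓ₂ ≡ false →
  Inserts ℓ₂ (remove S ℓ₁) (exchange S ℓ₁ ℓ₂)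
exchange-inserts {S = S} {ℓ₁} {ℓ₂} Sℓ₂ = record
  { absent = cong (λ b → b ∧ not (eqPos ℓ₂ ℓ₁)) Sℓ₂
  ; present = trans (cong (remove S ℓ₁ ℓ₂ ∨_) (eqPos-refl ℓ₂)) (∨-zeroʳ _)
  ; agrees = λ {q} q≢ℓ₂ → trans (cong (remove S ℓ₁ q ∨_) (eqPos-false q≢ℓ₂)) (∨-identityʳ _)
  }

module _ {t} {ℓ : Pos t} {R S : LeafSet t} (ins : Inserts ℓ R S) where

  inserts-⊆ : R ⊆ S
  inserts-⊆ {q} Rq with q ≟ ℓ
  ... | yes refl = present ins
  ... | no q≢ℓ = trans (agrees ins q≢ℓ) Rq

  inserts-removes : ∀ {d} → IsLeaf ℓ → Confined S d ℓ → NoneBelow R d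
  inserts-removes leaf conf {q} d⊑q Rq with q ≟ ℓ
  ... | yes refl = not-¬ Rq (absent ins)
  ... | no q≢ℓ = q≢ℓ (sym (leaf-maximal leaf (conf d⊑q (trans (agrees ins q≢ℓ) Rq))))

  inserts-only : ∀ {d} → NoneBelow R d → Confined S d ℓ
  inserts-only none {q} d⊑q Sq with q ≟ ℓ
  ... | yes refl = ⊑-refl
  ... | no q≢ℓ = ⊥-elim (none d⊑q (trans (sym (agrees ins q≢ℓ)) Sq))

  inserts-avoid : ∀ {d} → NoneBelow R d → ¬ d ⊑ ℓ → NoneBelow S d
  inserts-avoid none d⋢ℓ {q} d⊑q Sq with q ≟ ℓ
  ... | yes refl = d⋢ℓ d⊑q
  ... | no q≢ℓ = none d⊑q (trans (sym (agrees ins q≢ℓ)) Sq)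

  inserts-confined : ∀ {w w'} → Confined R w w' → w' ⊑ ℓ → Confined S w w'
  inserts-confined conf w'⊑ℓ {q} w⊑q Sq with q ≟ ℓ
  ... | yes refl = w'⊑ℓ
  ... | no q≢ℓ = conf w⊑q (trans (sym (agrees ins q≢ℓ)) Sq)

confined-⊆ : ∀ {t} {R S : LeafSet t} {w w' : Pos t} → R ⊆ S → Confined S w w' → Confined R w w'
confined-⊆ R⊆S conf w⊑q Rq = conf w⊑q (R⊆S Rq)

restrictAt-pendant : ∀ {t} {R S : LeafSet t} {ℓ w a b : Pos t} → Inserts ℓ R S → IsLeaf ℓ →
  Children w a b → a ⊑ ℓ → Confined S a ℓ → restrictAt S w ≅M combine (just lf) (restrictAt R w)
restrictAt-pendant {R = R} {S} {ℓ} {w} {a} {b} ins leaf ch a⊑ℓ conf = begin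
  restrictAt S w                              ≈⟨ children-split ch S ⟩
  combine (restrictAt S a) (restrictAt S b)   ≡⟨ cong₂ combine at-a at-b ⟩
  combine (just lf) (restrictAt R b)
    ≈⟨ combine-cong ≅M-refl (restrictAt-empty-child ch (inserts-removes ins leaf conf)) ⟨
  combine (just lf) (restrictAt R w)          ∎
  where
  at-a : restrictAt S a ≡ just lf
  at-a = trans (restrictAt-collapse a⊑ℓ conf) (restrictAt-leaf ℓ leaf (present ins))
  at-b : restrictAt S b ≡ restrictAt R b
  at-b = restrictAt-cong b λ b⊑q → agrees ins λ { refl → children-disjoint ch a⊑ℓ b⊑q }

module _ {t} {S : LeafSet t} (S-leaves : (p : Pos t) → S p ≡ true → IsLeaf p)
         {λ₁ λ₂ : Pos t} (Sλ₁ : S λ₁ ≡ true) (λ₂-leaf : IsLeaf λ₂) (Sλ₂ : S λ₂ ≡ false) where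

  private
    R S' : LeafSet t
    R = remove S λ₁
    S' = exchange S λ₁ λ₂

    λ₁-leaf : IsLeaf λ₁
    λ₁-leaf = S-leaves λ₁ Sλ₁

    λ₁-inserted : Inserts λ₁ R S
    λ₁-inserted = remove-inserts Sλ₁

    λ₂-inserted : Inserts λ₂ R S'
    λ₂-inserted = exchange-inserts Sλ₂

  exchange-≅ : ∀ {w} → w ⊑ λ₁ → w ⊑ λ₂ → restrictAt S w ≅M restrictAt S' w → restrict t S ≅M restrict t S'
  exchange-≅ {w} w⊑λ₁ w⊑λ₂ = restrictAt-≅⇒restrict-≅ w λ w⋢q →
    trans (agrees λ₁-inserted λ { refl → w⋢q w⊑λ₁ }) (sym (agrees λ₂-inserted λ { refl → w⋢q w⊑λ₂ }))

  parent-children : ∀ {pv} → EdgeS S (ps pv) (ps λ₁) →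
    ∃₂ λ d₁ d₂ → Children pv d₁ d₂ × d₁ ⊑ λ₁ × Confined S d₁ λ₁
  parent-children edge@(_ , _ , _ , pv⊏λ₁ , _) with child-toward (ps-⊏ pv⊏λ₁)
  ... | d₁ , d₂ , ch , d₁⊑λ₁ = d₁ , d₂ , ch , d₁⊑λ₁ ,
    branchFree⇒confined S-leaves d₁⊑λ₁ (λ₁ , ⊑-refl , Sλ₁) (edge-branchFree edge (⊏-ps (children-⊏ ch)) ⊑V-refl)

  span-avoids-λ₂ : ∀ {p} → InSpan S p → p ≢ λ₂
  span-avoids-λ₂ (s , p⊑s , Ss) refl =
    not-¬ Ss (subst (λ z → S z ≡ false) (leaf-maximal λ₂-leaf p⊑s) Sλ₂)

  restrictAt-scar : ∀ {px} → ScarVertex S λ₂ (ps px) →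
    restrictAt S' px ≅M combine (just lf) (restrictAt R px)
  restrictAt-scar (ps⊑ px⊑λ₂ , px-span , maximal) with child-toward (px⊑λ₂ , span-avoids-λ₂ px-span)
  ... | e₂ , _ , ch , e₂⊑λ₂ = restrictAt-pendant λ₂-inserted λ₂-leaf ch e₂⊑λ₂ (inserts-only λ₂-inserted none)
    where
    none : NoneBelow R e₂
    none e₂⊑q Rq with children-⊏ ch | maximal (ps e₂) (ps⊑ e₂⊑λ₂) (_ , e₂⊑q , inserts-⊆ λ₁-inserted Rq)
    ... | px⊑e₂ , px≢e₂ | ps⊑ e₂⊑px = px≢e₂ (⊑-antisym px⊑e₂ e₂⊑px)

  scar-above-parent : ∀ {pv px u} → EdgeS S (ps pv) (ps λ₁) → ScarVertex S λ₂ (ps px) →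
    EdgeS S u (ps pv) → Interior (ps px) u (ps pv) → restrict t S ≅M restrict t S'
  scar-above-parent {pv} {px} edge@(_ , _ , _ , (ps⊑ pv⊑λ₁ , _) , _) scar@(ps⊑ px⊑λ₂ , _) edge-u
    (u⊏px , (ps⊑ px⊑pv , _)) with parent-children edge
  ... | _ , _ , ch , d₁⊑λ₁ , conf₁ = exchange-≅ (⊑-trans px⊑pv pv⊑λ₁) px⊑λ₂ (begin
    restrictAt S px                       ≡⟨ restrictAt-collapse px⊑pv conf ⟩
    restrictAt S pv                       ≈⟨ restrictAt-pendant λ₁-inserted λ₁-leaf ch d₁⊑λ₁ conf₁ ⟩
    combine (just lf) (restrictAt R pv)
      ≡⟨ cong (combine (just lf)) (restrictAt-collapse px⊑pv (confined-⊆ (inserts-⊆ λ₁-inserted) conf)) ⟨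
    combine (just lf) (restrictAt R px)   ≈⟨ restrictAt-scar scar ⟨
    restrictAt S' px                      ∎)
    where
    conf : Confined S px pv
    conf = branchFree⇒confined S-leaves px⊑pv (λ₁ , pv⊑λ₁ , Sλ₁) (edge-branchFree edge-u u⊏px ⊑V-refl)

  scar-on-pendant-edge : ∀ {pv d₁ d₂} → Children pv d₁ d₂ → d₁ ⊑ λ₁ → Confined S d₁ λ₁ → d₁ ⊑ λ₂ →
    restrictAt S pv ≅M restrictAt S' pv
  scar-on-pendant-edge {pv} ch d₁⊑λ₁ conf d₁⊑λ₂ = begin
    restrictAt S pv                       ≈⟨ restrictAt-pendant λ₁-inserted λ₁-leaf ch d₁⊑λ₁ conf ⟩
    combine (just lf) (restrictAt R pv)
      ≈⟨ restrictAt-pendant λ₂-inserted λ₂-leaf ch d₁⊑λ₂ (inserts-only λ₂-inserted (inserts-removes λ₁-inserted λ₁-leaf conf)) ⟨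
    restrictAt S' pv                      ∎

  scar-below-sibling : ∀ {pv d₁ d₂ px} → Children pv d₁ d₂ → d₁ ⊑ λ₁ → Confined S d₁ λ₁ →
    ScarVertex S λ₂ (ps px) → d₂ ⊑ px → Confined S d₂ px → restrictAt S pv ≅M restrictAt S' pv
  scar-below-sibling {pv} {d₁} {d₂} {px} ch d₁⊑λ₁ conf₁ scar@(ps⊑ px⊑λ₂ , _) d₂⊑px conf₂ = begin
    restrictAt S pv                       ≈⟨ restrictAt-pendant λ₁-inserted λ₁-leaf ch d₁⊑λ₁ conf₁ ⟩
    combine (just lf) (restrictAt R pv)   ≈⟨ combine-cong ≅M-refl (restrictAt-empty-child ch none-R) ⟩
    combine (just lf) (restrictAt R d₂)   ≡⟨ cong (combine (just lf)) (restrictAt-collapse d₂⊑px conf-R) ⟩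
    combine (just lf) (restrictAt R px)   ≈⟨ restrictAt-scar scar ⟨
    restrictAt S' px                      ≡⟨ restrictAt-collapse d₂⊑px (inserts-confined λ₂-inserted conf-R px⊑λ₂) ⟨
    restrictAt S' d₂                      ≈⟨ restrictAt-empty-child ch (inserts-avoid λ₂-inserted none-R d₁⋢λ₂) ⟨
    restrictAt S' pv                      ∎
    where
    none-R : NoneBelow R d₁
    none-R = inserts-removes λ₁-inserted λ₁-leaf conf₁
    conf-R : Confined R d₂ px
    conf-R = confined-⊆ (inserts-⊆ λ₁-inserted) conf₂
    d₁⋢λ₂ : ¬ d₁ ⊑ λ₂
    d₁⋢λ₂ d₁⊑λ₂ = children-disjoint ch d₁⊑λ₂ (⊑-trans d₂⊑px px⊑λ₂)

  scar-below-parent : ∀ {pv px c} → EdgeS S (ps pv) (ps λ₁) → ScarVertex S λ₂ (ps px) →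
    EdgeS S (ps pv) c → Interior (ps px) (ps pv) c → restrict t S ≅M restrict t S'
  scar-below-parent {pv} {px} edge@(_ , _ , _ , (ps⊑ pv⊑λ₁ , _) , _) scar@(ps⊑ px⊑λ₂ , px-span , _) edge-c
    (pv⊏px , (px⊑c , _)) with parent-children edge
  ... | d₁ , d₂ , ch , d₁⊑λ₁ , conf₁ =
    exchange-≅ pv⊑λ₁ (⊑-trans (proj₁ (ps-⊏ pv⊏px)) px⊑λ₂) (side (children-cover ch (ps-⊏ pv⊏px)))
    where
    side : d₁ ⊑ px ⊎ d₂ ⊑ px → restrictAt S pv ≅M restrictAt S' pv
    side (inj₁ d₁⊑px) = scar-on-pendant-edge ch d₁⊑λ₁ conf₁ (⊑-trans d₁⊑px px⊑λ₂)
    side (inj₂ d₂⊑px) = scar-below-sibling ch d₁⊑λ₁ conf₁ scar d₂⊑px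
      (branchFree⇒confined S-leaves d₂⊑px px-span (edge-branchFree edge-c (⊏-ps (children-⊏ (children-sym ch))) px⊑c))

lemma2 : (t : BTree) (S : LeafSet t) →
    ((p : Pos t) → S p ≡ true → IsLeaf p) →
    AtLeastTwo S →
    (λ₁ : Pos t) → S λ₁ ≡ true →
    (v : V t) → EdgeS S v (ps λ₁) →
    (λ₂ : Pos t) → IsLeaf λ₂ → S λ₂ ≡ false →
    (x : V t) → ScarVertex S λ₂ x →
    (Σ (V t) (λ u → EdgeS S u v × Interior x u v)
      ⊎ Σ (V t) (λ c → EdgeS S v c × Interior x v c)) →
    restrict t S ≅M restrict t (exchange S λ₁ λ₂)
lemma2 _ _ leaves two _ Sλ₁ rt edge _ _ _ _ _ _ =
  ⊥-elim (parent-not-root leaves two Sλ₁ edge)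
lemma2 _ _ _ _ _ _ (ps _) _ _ _ _ rt _ (inj₁ (_ , _ , (rt⊑ , rt≢rt) , _)) = ⊥-elim (rt≢rt refl)
lemma2 _ _ _ _ _ _ (ps _) _ _ _ _ rt _ (inj₂ (_ , _ , (() , _) , _))
lemma2 _ _ leaves _ _ Sλ₁ (ps _) edge _ λ₂-leaf Sλ₂ (ps _) scar (inj₁ (_ , edge-u , interior)) =
  scar-above-parent leaves Sλ₁ λ₂-leaf Sλ₂ edge scar edge-u interior
lemma2 _ _ leaves _ _ Sλ₁ (ps _) edge _ λ₂-leaf Sλ₂ (ps _) scar (inj₂ (_ , edge-c , interior)) =
  scar-below-parent leaves Sλ₁ λ₂-leaf Sλ₂ edge scar edge-c interior
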